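{- Let $R$ be a commutative ring with identity and $\mathbf a,\mathbf b\in\mathcal W(R)$. Then $\mathbf a\boxtimes\mathbf b=[(\mathbf a\star\mathbf 1)\odot(\mathbf b\star\mathbf 1)]\star\mathbf e$, where $\mathbf 1=(1,1,1,\dots)$ and $\mathbf e=((-1)^n)_{n\ge0}$.
   Context: $\mathcal S(R)$ is the set of sequences $(a_n)_{n\ge0}$ in $R$; $\mathcal W(R)\subset\mathcal S(R)$ is the set of linear recurrent sequences, i.e. sequences satisfying $a_n=\sum_{i=1}^{N}h_ia_{n-i}$ for all $n\ge N$, for some $N$ and $h_1,\dots,h_N\in R$. Operations: Hadamard product $(\mathbf a\odot\mathbf b)_n=a_nb_n$; Hurwitz product $(\mathbf a\star\mathbf b)_n=\sum_{i=0}^n\binom{n}{i}a_ib_{n-i}$; Newton (multinomial convolution) product $(\mathbf a\boxtimes\mathbf b)_n=\sum_{i=0}^n\sum_{j=0}^i\binom{n}{i}\binom{i}{j}a_ib_{n-j}$. -}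

module Defs where

open import Level using (Level)
open import Data.Nat as ℕ using (ℕ; zero; suc; _≤_)
open import Data.Nat.Combinatorics using (_C_)
open import Data.Product using (Σ)
open import Algebra.Bundles using (CommutativeRing; Semiring)
import Algebra.Definitions.RawSemiring as RS

module Seq {c ℓ : Level} (R : CommutativeRing c ℓ) where
  open CommutativeRing R hiding (zero)
  open RS (Semiring.rawSemiring semiring) using ()
    renaming (_×_ to _·_)

  Sequence : Set c
  Sequence = ℕ → Carrier

  sumFrom0 : ℕ → (ℕ → Carrier) → Carrier
  sumFrom0 zero    f = f zero
  sumFrom0 (suc n) f = sumFrom0 n f + f (suc n)

  sumFrom1 : ℕ → (ℕ → Carrier) → Carrier
  sumFrom1 zero    f = 0#
  sumFrom1 (suc n) f = sumFrom1 n f + f (suc n)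

  IsLinearRecurrent : Sequence → Set (c Level.⊔ ℓ)
  IsLinearRecurrent a =
    Σ ℕ λ N → Σ (ℕ → Carrier) λ h →
      ∀ n → N ≤ n → a n ≈ sumFrom1 N (λ i → h i * a (n ℕ.∸ i))

  _⊙_ : Sequence → Sequence → Sequence
  (a ⊙ b) n = a n * b n

  _⋆_ : Sequence → Sequence → Sequence
  (a ⋆ b) n = sumFrom0 n (λ i → (n C i) · (a i * b (n ℕ.∸ i)))

  _⊠_ : Sequence → Sequence → Sequence
  (a ⊠ b) n = sumFrom0 n (λ i → sumFrom0 i (λ j →
                 ((n C i) ℕ.* (i C j)) · (a i * b (n ℕ.∸ j))))

  𝟙 : Sequence
  𝟙 _ = 1#

  𝕖 : Sequence
  𝕖 zero    = 1#
  𝕖 (suc n) = - 𝕖 n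

  _≋_ : Sequence → Sequence → Set ℓ
  a ≋ b = ∀ n → a n ≈ b n

-- Let E be the shift (E a)ₙ = aₙ₊₁. By Pascal's rule E is a derivation of the Hurwitz
-- product, E(a ⋆ b) = Ea ⋆ b + a ⋆ Eb, and from this one checks that both sides
-- F(a, b) of the identity obey the same recursion
--   F(a, b)₀ = a₀b₀,   E F(a, b) = F(Ea, Eb) + F(Ea, b) + F(a, Eb);
-- for the right-hand side the extra term (w ⋆ 𝕖) + (w ⋆ E𝕖) cancels because E𝕖 = −𝕖.
-- Induction on n, generalised over a and b, then shows that the two sides agree.

module Submission where

open import Defs
open import Level using (Level)
open import Algebra.Bundles using (CommutativeRing; Semiring)
open import Data.Nat as ℕ using (ℕ; zero; suc; _≤_; _∸_; z≤n)
open import Data.Nat.Properties as ℕ using ()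
open import Data.Nat.Combinatorics using (_C_; k>n⇒nCk≡0; nCk+nC[k+1]≡[n+1]C[k+1])
open import Relation.Binary.PropositionalEquality as ≡ using (_≡_)
import Algebra.Definitions.RawSemiring as RawSemiringDefs
import Algebra.Properties.Semiring.Mult as SemiringMult
import Algebra.Properties.CommutativeMonoid.Mult as CommutativeMonoidMult
import Algebra.Properties.CommutativeSemigroup as CommutativeSemigroupProperties
import Algebra.Properties.Ring as RingProperties
import Algebra.Properties.AbelianGroup as AbelianGroupProperties
import Algebra.Properties.Group as GroupProperties
import Relation.Binary.Reasoning.Setoid as SetoidReasoning

m∸n+[n∸o]≡m∸o : ∀ {m n o} → o ≤ n → n ≤ m → (m ∸ n) ℕ.+ (n ∸ o) ≡ m ∸ o
m∸n+[n∸o]≡m∸o {m} {n} {o} o≤n n≤m = begin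
  (m ∸ n) ℕ.+ (n ∸ o) ≡⟨ ℕ.+-∸-assoc (m ∸ n) o≤n ⟨
  (m ∸ n) ℕ.+ n ∸ o   ≡⟨ ≡.cong (_∸ o) (ℕ.m∸n+n≡m n≤m) ⟩
  m ∸ o               ∎
  where open ≡.≡-Reasoning

module NewtonHurwitz {c ℓ : Level} (R : CommutativeRing c ℓ) where
  open CommutativeRing R hiding (zero)
  open Seq R
  open RawSemiringDefs (Semiring.rawSemiring semiring) using () renaming (_×_ to _·_)
  open SemiringMult semiring using (×-congʳ; ×-congˡ; ×-homo-1; ×-homo-+; ×-assocˡ; ×-comm-*)
  open CommutativeMonoidMult +-commutativeMonoid using (×-distrib-+)
  open CommutativeSemigroupProperties +-commutativeSemigroup using (interchange; x∙yz≈y∙xz)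
  open RingProperties ring using (-‿distribʳ-*)
  open AbelianGroupProperties +-abelianGroup using (⁻¹-∙-comm)
  open GroupProperties +-group using (ε⁻¹≈ε; //-rightDividesʳ)
  open SetoidReasoning setoid

  shift : Sequence → Sequence
  shift a n = a (suc n)

  drop : ℕ → Sequence → Sequence
  drop m a k = a (m ℕ.+ k)

  infixl 25 _⊕_
  infix 30 ⊖_

  _⊕_ : Sequence → Sequence → Sequence
  (a ⊕ b) n = a n + b n

  ⊖_ : Sequence → Sequence
  (⊖ a) n = - a n

  sumFrom0-cong : ∀ n {f g : ℕ → Carrier} → (∀ i → i ≤ n → f i ≈ g i) →
                  sumFrom0 n f ≈ sumFrom0 n g
  sumFrom0-cong zero    f≈g = f≈g 0 z≤n
  sumFrom0-cong (suc n) f≈g =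
    +-cong (sumFrom0-cong n (λ i i≤n → f≈g i (ℕ.m≤n⇒m≤1+n i≤n))) (f≈g (suc n) ℕ.≤-refl)

  sumFrom0-distrib-+ : ∀ n (f g : ℕ → Carrier) →
                       sumFrom0 n (λ i → f i + g i) ≈ sumFrom0 n f + sumFrom0 n g
  sumFrom0-distrib-+ zero    f g = refl
  sumFrom0-distrib-+ (suc n) f g = begin
    sumFrom0 n (λ i → f i + g i) + (f (suc n) + g (suc n))
      ≈⟨ +-congʳ (sumFrom0-distrib-+ n f g) ⟩
    (sumFrom0 n f + sumFrom0 n g) + (f (suc n) + g (suc n))
      ≈⟨ interchange _ _ _ _ ⟩
    (sumFrom0 n f + f (suc n)) + (sumFrom0 n g + g (suc n)) ∎

  sumFrom0-neg : ∀ n (f : ℕ → Carrier) → sumFrom0 n (λ i → - f i) ≈ - sumFrom0 n f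
  sumFrom0-neg zero    f = refl
  sumFrom0-neg (suc n) f = trans (+-congʳ (sumFrom0-neg n f)) (⁻¹-∙-comm _ _)

  sumFrom0-uncons : ∀ n (f : ℕ → Carrier) →
                    sumFrom0 (suc n) f ≈ f 0 + sumFrom0 n (λ i → f (suc i))
  sumFrom0-uncons zero    f = refl
  sumFrom0-uncons (suc n) f = trans (+-congʳ (sumFrom0-uncons n f)) (+-assoc _ _ _)

  *-distribˡ-sumFrom0 : ∀ n x (f : ℕ → Carrier) →
                        x * sumFrom0 n f ≈ sumFrom0 n (λ i → x * f i)
  *-distribˡ-sumFrom0 zero    x f = refl
  *-distribˡ-sumFrom0 (suc n) x f = trans (distribˡ x _ _) (+-congʳ (*-distribˡ-sumFrom0 n x f))

  ×-distribˡ-sumFrom0 : ∀ n k (f : ℕ → Carrier) →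
                        k · sumFrom0 n f ≈ sumFrom0 n (λ i → k · f i)
  ×-distribˡ-sumFrom0 zero    k f = refl
  ×-distribˡ-sumFrom0 (suc n) k f = trans (×-distrib-+ _ _ k) (+-congʳ (×-distribˡ-sumFrom0 n k f))

  ×-neg : ∀ k x → k · (- x) ≈ - (k · x)
  ×-neg zero    x = sym ε⁻¹≈ε
  ×-neg (suc k) x = trans (+-congˡ (×-neg k x)) (⁻¹-∙-comm x (k · x))

  -- a ⋆ b is binomialSum (λ i j → a i * b j) definitionally.
  binomialSum : (ℕ → ℕ → Carrier) → Sequence
  binomialSum f n = sumFrom0 n (λ i → (n C i) · f i (n ∸ i))

  binomialSum-cong : ∀ {f g : ℕ → ℕ → Carrier} → (∀ i j → f i j ≈ g i j) →
                     binomialSum f ≋ binomialSum g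
  binomialSum-cong f≈g n = sumFrom0-cong n (λ i _ → ×-congʳ (n C i) (f≈g i (n ∸ i)))

  binomialSum-distrib-+ : ∀ (f g : ℕ → ℕ → Carrier) →
    binomialSum (λ i j → f i j + g i j) ≋ binomialSum f ⊕ binomialSum g
  binomialSum-distrib-+ f g n =
    trans (sumFrom0-cong n (λ i _ → ×-distrib-+ _ _ (n C i))) (sumFrom0-distrib-+ n _ _)

  binomialSum-neg : ∀ (f : ℕ → ℕ → Carrier) →
                    binomialSum (λ i j → - f i j) ≋ ⊖ binomialSum f
  binomialSum-neg f n = trans (sumFrom0-cong n (λ i _ → ×-neg (n C i) _)) (sumFrom0-neg n _)

  binomialSum-zero : ∀ (f : ℕ → ℕ → Carrier) → binomialSum f 0 ≈ f 0 0
  binomialSum-zero f = ×-homo-1 (f 0 0)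

  -- Pascal's rule (n+1 choose i+1) = (n choose i) + (n choose i+1).
  binomialSum-suc : ∀ (f : ℕ → ℕ → Carrier) →
    shift (binomialSum f) ≋ binomialSum (λ i j → f (suc i) j) ⊕ binomialSum (λ i j → f i (suc j))
  binomialSum-suc f n = begin
    binomialSum f (suc n)
      ≈⟨ sumFrom0-uncons n _ ⟩
    head + sumFrom0 n (λ k → (suc n C suc k) · f (suc k) (n ∸ k))
      ≈⟨ +-congˡ (sumFrom0-cong n λ k _ → begin
           (suc n C suc k) · f (suc k) (n ∸ k)
             ≡⟨ ≡.cong (_· f (suc k) (n ∸ k)) (nCk+nC[k+1]≡[n+1]C[k+1] n k) ⟨
           (n C k ℕ.+ n C suc k) · f (suc k) (n ∸ k)
             ≈⟨ ×-homo-+ _ (n C k) (n C suc k) ⟩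
           (n C k) · f (suc k) (n ∸ k) + (n C suc k) · f (suc k) (n ∸ k) ∎) ⟩
    head + sumFrom0 n (λ k → (n C k) · f (suc k) (n ∸ k) + (n C suc k) · f (suc k) (n ∸ k))
      ≈⟨ +-congˡ (sumFrom0-distrib-+ n _ _) ⟩
    head + (binomialSum (λ i j → f (suc i) j) n + upperTail)
      ≈⟨ x∙yz≈y∙xz head _ upperTail ⟩
    binomialSum (λ i j → f (suc i) j) n + (head + upperTail)
      ≈⟨ +-congˡ (sym (sumFrom0-uncons n _)) ⟩
    binomialSum (λ i j → f (suc i) j) n + sumFrom0 (suc n) (λ i → (n C i) · f i (suc n ∸ i))
      ≈⟨ +-congˡ (+-cong (sumFrom0-cong n λ i i≤n →
                            reflexive (≡.cong (λ j → (n C i) · f i j) (ℕ.+-∸-assoc 1 i≤n)))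
                         (×-congˡ (k>n⇒nCk≡0 {n} {suc n} ℕ.≤-refl))) ⟩
    binomialSum (λ i j → f (suc i) j) n + (binomialSum (λ i j → f i (suc j)) n + 0#)
      ≈⟨ +-congˡ (+-identityʳ _) ⟩
    binomialSum (λ i j → f (suc i) j) n + binomialSum (λ i j → f i (suc j)) n ∎
    where
    head upperTail : Carrier
    head      = (suc n C 0) · f 0 (suc n)
    upperTail = sumFrom0 n (λ k → (n C suc k) · f (suc k) (n ∸ k))

  hurwitz-zero : ∀ a b → (a ⋆ b) 0 ≈ a 0 * b 0
  hurwitz-zero a b = binomialSum-zero (λ i j → a i * b j)

  shift-⋆ : ∀ a b → shift (a ⋆ b) ≋ (shift a ⋆ b) ⊕ (a ⋆ shift b)
  shift-⋆ a b = binomialSum-suc (λ i j → a i * b j)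

  ⋆-congˡ : ∀ {a a′} b → a ≋ a′ → (a ⋆ b) ≋ (a′ ⋆ b)
  ⋆-congˡ {a} {a′} b a≋a′ =
    binomialSum-cong {λ i j → a i * b j} {λ i j → a′ i * b j} (λ i j → *-congʳ (a≋a′ i))

  ⋆-congʳ : ∀ a {b b′} → b ≋ b′ → (a ⋆ b) ≋ (a ⋆ b′)
  ⋆-congʳ a {b} {b′} b≋b′ =
    binomialSum-cong {λ i j → a i * b j} {λ i j → a i * b′ j} (λ i j → *-congˡ (b≋b′ j))

  ⋆-distribʳ-⊕ : ∀ a a′ b → ((a ⊕ a′) ⋆ b) ≋ (a ⋆ b) ⊕ (a′ ⋆ b)
  ⋆-distribʳ-⊕ a a′ b n =
    trans (binomialSum-cong (λ i j → distribʳ (b j) (a i) (a′ i)) n)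
          (binomialSum-distrib-+ (λ i j → a i * b j) (λ i j → a′ i * b j) n)

  ⋆-negʳ : ∀ a b → (a ⋆ (⊖ b)) ≋ ⊖ (a ⋆ b)
  ⋆-negʳ a b n =
    trans (binomialSum-cong (λ i j → sym (-‿distribʳ-* (a i) (b j))) n)
          (binomialSum-neg (λ i j → a i * b j) n)

  record NewtonRecursive (F : Sequence → Sequence → Sequence) : Set (c Level.⊔ ℓ) where
    field
      at-zero : ∀ a b → F a b 0 ≈ a 0 * b 0
      at-suc  : ∀ a b → shift (F a b) ≋ F (shift a) (shift b) ⊕ F (shift a) b ⊕ F a (shift b)

  newtonRecursive-unique : ∀ {F G} → NewtonRecursive F → NewtonRecursive G →
                           ∀ a b → F a b ≋ G a b
  newtonRecursive-unique F-rec G-rec a b zero =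
    trans (NewtonRecursive.at-zero F-rec a b) (sym (NewtonRecursive.at-zero G-rec a b))
  newtonRecursive-unique {F} {G} F-rec G-rec a b (suc n) = begin
    F a b (suc n)
      ≈⟨ NewtonRecursive.at-suc F-rec a b n ⟩
    F (shift a) (shift b) n + F (shift a) b n + F a (shift b) n
      ≈⟨ +-cong (+-cong (unique (shift a) (shift b) n) (unique (shift a) b n)) (unique a (shift b) n) ⟩
    G (shift a) (shift b) n + G (shift a) b n + G a (shift b) n
      ≈⟨ NewtonRecursive.at-suc G-rec a b n ⟨
    G a b (suc n) ∎
    where
    unique : ∀ a b → F a b ≋ G a b
    unique = newtonRecursive-unique F-rec G-rec

  -- (a ⊠ b)ₙ = Σᵢ (n choose i) aᵢ (𝟙 ⋆ E^{n−i} b)ᵢ: the inner sum of ⊠ is a Hurwitz product.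
  newtonKernel : Sequence → Sequence → ℕ → ℕ → Carrier
  newtonKernel a b i m = a i * (𝟙 ⋆ drop m b) i

  newtonBinomial : Sequence → Sequence → Sequence
  newtonBinomial a b = binomialSum (newtonKernel a b)

  ⊠≋newtonBinomial : ∀ a b → (a ⊠ b) ≋ newtonBinomial a b
  ⊠≋newtonBinomial a b n = sumFrom0-cong n λ i i≤n → begin
    sumFrom0 i (λ j → ((n C i) ℕ.* (i C j)) · (a i * b (n ∸ j)))
      ≈⟨ sumFrom0-cong i (λ j j≤i → term i j j≤i i≤n) ⟩
    sumFrom0 i (λ j → (n C i) · (a i * ((i C j) · (1# * b (n ∸ i ℕ.+ (i ∸ j))))))
      ≈⟨ ×-distribˡ-sumFrom0 i (n C i) _ ⟨
    (n C i) · sumFrom0 i (λ j → a i * ((i C j) · (1# * b (n ∸ i ℕ.+ (i ∸ j)))))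
      ≈⟨ ×-congʳ (n C i) (*-distribˡ-sumFrom0 i (a i) _) ⟨
    (n C i) · (a i * (𝟙 ⋆ drop (n ∸ i) b) i) ∎
    where
    term : ∀ i j → j ≤ i → i ≤ n →
           ((n C i) ℕ.* (i C j)) · (a i * b (n ∸ j)) ≈
           (n C i) · (a i * ((i C j) · (1# * b (n ∸ i ℕ.+ (i ∸ j)))))
    term i j j≤i i≤n = begin
      ((n C i) ℕ.* (i C j)) · (a i * b (n ∸ j))
        ≈⟨ ×-assocˡ _ (n C i) (i C j) ⟨
      (n C i) · ((i C j) · (a i * b (n ∸ j)))
        ≈⟨ ×-congʳ (n C i) (×-comm-* (i C j) (a i) _) ⟨
      (n C i) · (a i * ((i C j) · b (n ∸ j)))
        ≡⟨ ≡.cong (λ k → (n C i) · (a i * ((i C j) · b k))) (m∸n+[n∸o]≡m∸o j≤i i≤n) ⟨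
      (n C i) · (a i * ((i C j) · b (n ∸ i ℕ.+ (i ∸ j))))
        ≈⟨ ×-congʳ (n C i) (*-congˡ (×-congʳ (i C j) (*-identityˡ _))) ⟨
      (n C i) · (a i * ((i C j) · (1# * b (n ∸ i ℕ.+ (i ∸ j))))) ∎

  newtonBinomial-recursive : NewtonRecursive newtonBinomial
  newtonBinomial-recursive = record { at-zero = at-zero ; at-suc = at-suc }
    where
    at-zero : ∀ a b → newtonBinomial a b 0 ≈ a 0 * b 0
    at-zero a b = begin
      newtonBinomial a b 0 ≈⟨ binomialSum-zero (newtonKernel a b) ⟩
      a 0 * (𝟙 ⋆ b) 0    ≈⟨ *-congˡ (trans (hurwitz-zero 𝟙 b) (*-identityˡ (b 0))) ⟩
      a 0 * b 0            ∎

    shift-drop : ∀ m b → shift (drop m b) ≋ drop m (shift b)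
    shift-drop m b k = reflexive (≡.cong b (ℕ.+-suc m k))

    -- drop (suc m) b and drop m (shift b) agree definitionally.
    at-suc : ∀ a b → shift (newtonBinomial a b) ≋
      newtonBinomial (shift a) (shift b) ⊕ newtonBinomial (shift a) b ⊕ newtonBinomial a (shift b)
    at-suc a b n = begin
      newtonBinomial a b (suc n)
        ≈⟨ binomialSum-suc (newtonKernel a b) n ⟩
      binomialSum (λ i m → a (suc i) * (𝟙 ⋆ drop m b) (suc i)) n + newtonBinomial a (shift b) n
        ≈⟨ +-congʳ (binomialSum-cong (λ i m → *-congˡ {a (suc i)} (begin
             (𝟙 ⋆ drop m b) (suc i)
               ≈⟨ shift-⋆ 𝟙 (drop m b) i ⟩
             (𝟙 ⋆ drop m b) i + (𝟙 ⋆ shift (drop m b)) i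
               ≈⟨ +-comm _ _ ⟩
             (𝟙 ⋆ shift (drop m b)) i + (𝟙 ⋆ drop m b) i
               ≈⟨ +-congʳ (⋆-congʳ 𝟙 (shift-drop m b) i) ⟩
             (𝟙 ⋆ drop m (shift b)) i + (𝟙 ⋆ drop m b) i ∎)) n) ⟩
      binomialSum (λ i m → a (suc i) * ((𝟙 ⋆ drop m (shift b)) i + (𝟙 ⋆ drop m b) i)) n
        + newtonBinomial a (shift b) n
        ≈⟨ +-congʳ (trans (binomialSum-cong (λ i m →
                              distribˡ (a (suc i)) ((𝟙 ⋆ drop m (shift b)) i) ((𝟙 ⋆ drop m b) i)) n)
                          (binomialSum-distrib-+ (newtonKernel (shift a) (shift b))
                                                 (newtonKernel (shift a) b) n)) ⟩
      newtonBinomial (shift a) (shift b) n + newtonBinomial (shift a) b n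
        + newtonBinomial a (shift b) n ∎

  hurwitzHadamard : Sequence → Sequence → Sequence
  hurwitzHadamard a b = ((a ⋆ 𝟙) ⊙ (b ⋆ 𝟙)) ⋆ 𝕖

  *-expand : ∀ x′ x y′ y → (x′ + x) * (y′ + y) ≈ x′ * y′ + x′ * y + x * y′ + x * y
  *-expand x′ x y′ y = begin
    (x′ + x) * (y′ + y)                       ≈⟨ distribʳ _ x′ x ⟩
    x′ * (y′ + y) + x * (y′ + y)              ≈⟨ +-cong (distribˡ x′ y′ y) (distribˡ x y′ y) ⟩
    (x′ * y′ + x′ * y) + (x * y′ + x * y)     ≈⟨ +-assoc _ (x * y′) (x * y) ⟨
    x′ * y′ + x′ * y + x * y′ + x * y         ∎

  hurwitzHadamard-recursive : NewtonRecursive hurwitzHadamard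
  hurwitzHadamard-recursive = record { at-zero = at-zero ; at-suc = at-suc }
    where
    at-zero : ∀ a b → hurwitzHadamard a b 0 ≈ a 0 * b 0
    at-zero a b = begin
      hurwitzHadamard a b 0           ≈⟨ trans (hurwitz-zero ((a ⋆ 𝟙) ⊙ (b ⋆ 𝟙)) 𝕖) (*-identityʳ _) ⟩
      (a ⋆ 𝟙) 0 * (b ⋆ 𝟙) 0           ≈⟨ *-cong (hurwitz-zero a 𝟙) (hurwitz-zero b 𝟙) ⟩
      (a 0 * 1#) * (b 0 * 1#)         ≈⟨ *-cong (*-identityʳ (a 0)) (*-identityʳ (b 0)) ⟩
      a 0 * b 0                       ∎

    at-suc : ∀ a b → shift (hurwitzHadamard a b) ≋
      hurwitzHadamard (shift a) (shift b) ⊕ hurwitzHadamard (shift a) b ⊕ hurwitzHadamard a (shift b)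
    at-suc a b n = begin
      (w ⋆ 𝕖) (suc n)
        ≈⟨ shift-⋆ w 𝕖 n ⟩
      (shift w ⋆ 𝕖) n + (w ⋆ (⊖ 𝕖)) n
        ≈⟨ +-cong (⋆-congˡ 𝕖 shift-w n) (⋆-negʳ w 𝕖 n) ⟩
      (((u′ ⊙ v′) ⊕ (u′ ⊙ v) ⊕ (u ⊙ v′) ⊕ w) ⋆ 𝕖) n - (w ⋆ 𝕖) n
        ≈⟨ +-congʳ (trans (⋆-distribʳ-⊕ _ w 𝕖 n)
                   (+-congʳ (trans (⋆-distribʳ-⊕ _ (u ⊙ v′) 𝕖 n)
                            (+-congʳ (⋆-distribʳ-⊕ (u′ ⊙ v′) (u′ ⊙ v) 𝕖 n))))) ⟩
      (((u′ ⊙ v′) ⋆ 𝕖) n + ((u′ ⊙ v) ⋆ 𝕖) n + ((u ⊙ v′) ⋆ 𝕖) n) + (w ⋆ 𝕖) n - (w ⋆ 𝕖) n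
        ≈⟨ //-rightDividesʳ _ _ ⟩
      ((u′ ⊙ v′) ⋆ 𝕖) n + ((u′ ⊙ v) ⋆ 𝕖) n + ((u ⊙ v′) ⋆ 𝕖) n ∎
      where
      u v u′ v′ w : Sequence
      u = a ⋆ 𝟙
      v = b ⋆ 𝟙
      u′ = shift a ⋆ 𝟙
      v′ = shift b ⋆ 𝟙
      w = u ⊙ v

      shift-w : shift w ≋ (u′ ⊙ v′) ⊕ (u′ ⊙ v) ⊕ (u ⊙ v′) ⊕ w
      shift-w k = trans (*-cong (shift-⋆ a 𝟙 k) (shift-⋆ b 𝟙 k)) (*-expand _ _ _ _)

  ⊠≋hurwitzHadamard : ∀ a b → (a ⊠ b) ≋ hurwitzHadamard a b
  ⊠≋hurwitzHadamard a b n =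
    trans (⊠≋newtonBinomial a b n)
          (newtonRecursive-unique newtonBinomial-recursive hurwitzHadamard-recursive a b n)

proposition7 : {c ℓ : Level} (R : CommutativeRing c ℓ) → let open Seq R in
    (a b : Sequence) → IsLinearRecurrent a → IsLinearRecurrent b →
    (a ⊠ b) ≋ (((a ⋆ 𝟙) ⊙ (b ⋆ 𝟙)) ⋆ 𝕖)
proposition7 R a b _ _ = NewtonHurwitz.⊠≋hurwitzHadamard R a b
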